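{- Let $n\geq 2k+1$, $x\in X_{n,k}$, and $\gamma,\gamma'\in\Gamma(x)$. If $\gamma'$ is a child of $\gamma$, then $v(\gamma)>v(\gamma')$.
   Context: Let $k\geq1$, $n\geq 2k+1$, and $X_{n,k}$ be the set of binary strings of length $n$ with exactly $k$ ones, indices taken cyclically. Parenthesis matching: regarding $x$ cyclically, each $1$ is matched to the last $0$ of the shortest cyclic substring starting at this $1$ and going rightwards that contains equally many $0$s and $1$s; every $1$ is matched, and $n-2k$ zeros are unmatched. Let $\widehat{x}$ be the bi-infinite string with $\widehat{x}_i=x_{i \bmod n}$ for $i\in\mathbb{Z}$, with matched/unmatched status inherited, viewed as a lattice path: matched $1$ = up-step, matched $0$ = down-step, unmatched $0$ = flat step, heights normalized so flat steps lie at height $0$. Let $D$ be the set of Dyck words, $\varepsilon$ the empty word, $D'=\{1u0:u\in D\}$, and $\overline{z}$ the bitwise complement of $z$. Every $y\in D'$ of height $h$ decomposes uniquely as $y=10$ if $h=1$, and otherwise as $y=1u_1\,1u_2\cdots 1u_{h-2}\,1\,1\,v_0\,0\,v_1\,0\cdots 0\,v_{h-2}\,0\,0$ with $u_i\in D$, $\overline{v_i}\in D$. For a word $y$ occupying consecutive positions of $\mathbb{Z}$ (positions retained): $\Gamma(\varepsilon)=\emptyset$; if $y\in D\setminus(D'\cup\{\varepsilon\})$, $y=y_1\cdots y_\ell$ with $y_i\in D'$, then $\Gamma(y)=\bigcup_i\Gamma(y_i)$; if $y\in D'$, $\Gamma(y)=\bigcup_{i=1}^{h-2}\Gamma(u_i)\cup\bigcup_{i=0}^{h-2}\Gamma(\overline{v_i})\cup\{(A,B)\}$,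 where $\overline{v_i}$ is the complemented word occupying the same positions as $v_i$, $A$ is the set of positions of the $1$s of $y$ not in any $u_i$ or $v_i$, and $B$ the set of positions of the $0$s of $y$ not in any $u_i$ or $v_i$. $\Gamma(x)=\bigcup\Gamma(y)$ over all subwords $y\in D'$ of $\widehat{x}$ starting and ending at height $0$; its elements are gliders, with speed $v((A,B))=|A|=|B|$. The children of the glider $(A,B)$ created from $y\in D'$ are the gliders created directly in the next recursion level, i.e., for each $u_i$ and each $\overline{v_i}$, the gliders $(A',B')$ created from the factors in $D'$ of that word. -}

module Defs where

open import Data.Bool using (Bool; true; false; not; T; _∧_)
open import Data.Nat as ℕ using (ℕ; zero; suc; _⊔_; _∸_)
open import Data.Integer as ℤ using (ℤ; +_; _%ℕ_)
open import Data.Integer.DivMod using (n%ℕd<d)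
open import Data.Fin using (fromℕ<)
open import Data.Vec using (Vec; lookup)
open import Data.List using (List; []; _∷_; _++_; length; concat; concatMap; map)
open import Data.List.Relation.Unary.All using (All)
open import Data.List.Membership.Propositional using (_∈_)
open import Data.Product using (Σ; _×_; _,_; ∃; ∃-syntax; proj₁)
open import Data.Sum using (_⊎_)
open import Relation.Nullary using (¬_)
open import Relation.Binary.PropositionalEquality using (_≡_)

-- Binary strings: true = 1, false = 0.

countOnes : ∀ {n} → Vec Bool n → ℕ
countOnes Vec.[] = 0
countOnes (true Vec.∷ x) = suc (countOnes x)
countOnes (false Vec.∷ x) = countOnes x

-- the bi-infinite string x̂ with x̂_i = x_{i mod n}  (n = 0 is a dummy case)
xhat : ∀ {n} → Vec Bool n → ℤ → Bool
xhat {zero} x i = false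
xhat {suc m} x i = lookup x (fromℕ< (n%ℕd<d i (suc m)))

onesIn : ∀ {n} → Vec Bool n → ℤ → ℕ → ℕ
onesIn x i zero = 0
onesIn x i (suc l) = if' (xhat x i) ℕ.+ onesIn x (i ℤ.+ + 1) l
  where
  if' : Bool → ℕ
  if' true = 1
  if' false = 0

Balanced : ∀ {n} → Vec Bool n → ℤ → ℕ → Set
Balanced x i len = 2 ℕ.* onesIn x i len ≡ len

-- Parenthesis matching: the 1 at position i is matched to the 0 at position j,
-- j being the last position of the shortest (nonempty) window starting at i
-- (going rightwards) with equally many 0s and 1s.
MatchedTo : ∀ {n} → Vec Bool n → ℤ → ℤ → Set
MatchedTo x i j =
  xhat x i ≡ true ×
  Σ ℕ λ len → 0 ℕ.< len × j ℤ.+ + 1 ≡ i ℤ.+ + len × Balanced x i len ×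
    (∀ l → 0 ℕ.< l → l ℕ.< len → ¬ Balanced x i l)

Matched0 : ∀ {n} → Vec Bool n → ℤ → Set
Matched0 x j = xhat x j ≡ false × ∃[ i ] MatchedTo x i j

Flat : ∀ {n} → Vec Bool n → ℤ → Set
Flat x j = xhat x j ≡ false × ¬ Matched0 x j

StepVal : ∀ {n} → Vec Bool n → ℤ → ℤ → Set
StepVal x j s =
  (xhat x j ≡ true × s ≡ ℤ.1ℤ) ⊎ (Matched0 x j × s ≡ ℤ.-1ℤ) ⊎ (Flat x j × s ≡ ℤ.0ℤ)

data StepSum {n} (x : Vec Bool n) : ℤ → ℕ → ℤ → Set where
  nil  : ∀ {a} → StepSum x a 0 ℤ.0ℤ
  cons : ∀ {a l s t} → StepVal x a s → StepSum x (a ℤ.+ + 1) l t →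
         StepSum x a (suc l) (s ℤ.+ t)

-- The point just before position p (between steps p-1 and p) has height 0,
-- heights being normalized so that flat steps lie at height 0: there is a
-- flat step at some f < p and the steps f+1, ..., p-1 sum to 0.
Height0 : ∀ {n} → Vec Bool n → ℤ → Set
Height0 x p = ∃[ f ] Σ ℕ λ l →
  Flat x f × f ℤ.+ + suc l ≡ p × StepSum x (f ℤ.+ + 1) l ℤ.0ℤ

window : ∀ {n} → Vec Bool n → ℤ → ℕ → List Bool
window x p zero = []
window x p (suc l) = xhat x p ∷ window x (p ℤ.+ + 1) l

dyckFrom : ℕ → List Bool → Bool
dyckFrom zero [] = true
dyckFrom (suc h) [] = false
dyckFrom h (true ∷ w) = dyckFrom (suc h) w
dyckFrom zero (false ∷ w) = false
dyckFrom (suc h) (false ∷ w) = dyckFrom h w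

Dyck : List Bool → Set
Dyck w = T (dyckFrom 0 w)

Dyck' : List Bool → Set
Dyck' w = Σ (List Bool) λ u → Dyck u × w ≡ true ∷ u ++ false ∷ []

compl : List Bool → List Bool
compl = map not

-- maximal height of the path of w starting at height c (used for Dyck words,
-- which never go below 0, so truncated subtraction is harmless)
maxHeightFrom : ℕ → List Bool → ℕ
maxHeightFrom c [] = c
maxHeightFrom c (true ∷ w) = c ⊔ maxHeightFrom (suc c) w
maxHeightFrom c (false ∷ w) = c ⊔ maxHeightFrom (c ∸ 1) w

height : List Bool → ℕ
height = maxHeightFrom 0

-- Decomposition of y ∈ D' of height h into pieces:
--   letter1 / letter0 : the 1s / 0s not in any u_i or v_i (they form A / B)
--   uPart u           : a factor u_i ∈ D
--   vPart v           : a factor v_i with compl v_i ∈ D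

data Piece : Set where
  letter1 letter0 : Piece
  uPart vPart : List Bool → Piece

pieceWord : Piece → List Bool
pieceWord letter1 = true ∷ []
pieceWord letter0 = false ∷ []
pieceWord (uPart u) = u
pieceWord (vPart v) = v

flatten : List Piece → List Bool
flatten = concatMap pieceWord

-- 1u_1 1u_2 ... 1u_{h-2} 1 1 v_0 0 v_1 0 ... 0 v_{h-2} 0 0
shapeOf : List (List Bool) → List (List Bool) → List Piece
shapeOf us vs =
  concatMap (λ u → letter1 ∷ uPart u ∷ []) us ++
  letter1 ∷ letter1 ∷ concatMap (λ v → vPart v ∷ letter0 ∷ []) vs ++ letter0 ∷ []

data Shape : ℕ → List Piece → Set where
  shape1 : Shape 1 (letter1 ∷ letter0 ∷ [])
  shapeN : (us vs : List (List Bool)) → All Dyck us → All (λ v → Dyck (compl v)) vs →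
           length vs ≡ suc (length us) →
           Shape (2 ℕ.+ length us) (shapeOf us vs)

Decomposition : List Bool → ℕ → List Piece → Set
Decomposition y h cs = Dyck' y × height y ≡ h × Shape h cs × flatten cs ≡ y

layout : ℤ → List Piece → List (ℤ × Piece)
layout p [] = []
layout p (c ∷ cs) = (p , c) ∷ layout (p ℤ.+ + length (pieceWord c)) cs

posA : List (ℤ × Piece) → List ℤ
posA [] = []
posA ((q , letter1) ∷ r) = q ∷ posA r
posA (_ ∷ r) = posA r

posB : List (ℤ × Piece) → List ℤ
posB [] = []
posB ((q , letter0) ∷ r) = q ∷ posB r
posB (_ ∷ r) = posB r

-- the words on which Γ recurses: u_i and the complemented v_i (same positions)
subWords : List (ℤ × Piece) → List (ℤ × List Bool)
subWords [] = []
subWords ((q , uPart u) ∷ r) = (q , u) ∷ subWords r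
subWords ((q , vPart v) ∷ r) = (q , compl v) ∷ subWords r
subWords (_ ∷ r) = subWords r

offsets : ℤ → List (List Bool) → List (ℤ × List Bool)
offsets q [] = []
offsets q (w ∷ ws) = (q , w) ∷ offsets (q ℤ.+ + length w) ws

-- Gliders (A , B): A, B given as lists of positions (in increasing order)

Glider : Set
Glider = List ℤ × List ℤ

speed : Glider → ℕ
speed γ = length (proj₁ γ)

gliderOf : ℤ → List Piece → Glider
gliderOf p cs = posA (layout p cs) , posB (layout p cs)

-- Node x p y : y ∈ D' occupying positions from p is one of the words from
-- which Γ(x) creates a glider: either a subword of x̂ in D' starting and ending
-- at height 0, or a factor in D' (of the factorization into D'-words) of some
-- u_i or compl v_i of a decomposition of a node.
data Node {n} (x : Vec Bool n) : ℤ → List Bool → Set where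
  root  : (p : ℤ) (len : ℕ) → Height0 x p → Height0 x (p ℤ.+ + len) →
          Dyck' (window x p len) → Node x p (window x p len)
  inner : ∀ {p y h cs q w r y'} → Node x p y → Decomposition y h cs →
          (q , w) ∈ subWords (layout p cs) →
          (ys : List (List Bool)) → All Dyck' ys → concat ys ≡ w →
          (r , y') ∈ offsets q ys → Node x r y'

InΓ : ∀ {n} → Vec Bool n → Glider → Set
InΓ x γ = ∃[ p ] ∃[ y ] ∃[ h ] ∃[ cs ]
  Node x p y × Decomposition y h cs × γ ≡ gliderOf p cs

-- γ' is a child of γ (in Γ(x)): γ is created from a node y via a
-- decomposition, and γ' is created from a D'-factor of some u_i or compl v_i
-- of that decomposition.
Child : ∀ {n} → Vec Bool n → Glider → Glider → Set
Child x γ γ' = ∃[ p ] ∃[ y ] ∃[ h ] ∃[ cs ]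
  Node x p y × Decomposition y h cs × γ ≡ gliderOf p cs ×
  ∃[ q ] ∃[ w ] (q , w) ∈ subWords (layout p cs) ×
  ∃[ ys ] All Dyck' ys × concat ys ≡ w ×
  ∃[ r ] ∃[ y' ] (r , y') ∈ offsets q ys ×
  ∃[ h' ] ∃[ cs' ] Decomposition y' h' cs' × γ' ≡ gliderOf r cs'

{-# OPTIONS --safe #-}
-- The glider created from y = 1u0 ∈ D' has one letter of A per level, so its speed is the
-- height h of y, and height u = h - 1.  A child is created from a D'-factor of some u_i or
-- compl v_i, so its speed is at most the height of that word.  Now u_i is a Dyck infix of u,
-- hence of height at most height u; and v_i, starting at some height e of the path of u,
-- cannot descend below 0, so compl v_i has height at most e ≤ height u.  Either way the
-- child is slower.
module Submission where

open import Defs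
open import Data.Nat using (ℕ; zero; suc; _≤_; _<_; _*_; _+_; _⊔_; _∸_; z≤n; s≤s)
open import Data.Nat.Properties
open import Data.Bool using (Bool; true; false; T)
open import Data.Vec using (Vec)
open import Data.List using (List; []; _∷_; _++_; length; concat; concatMap)
open import Data.List.Properties using (concat-++; concatMap-++; ∷-injectiveʳ; ∷ʳ-injectiveˡ)
open import Data.List.Relation.Unary.All as All using (All; []; _∷_)
open import Data.List.Relation.Unary.All.Properties using (++⁺)
open import Data.List.Relation.Unary.Any using (here; there)
open import Data.List.Membership.Propositional using (_∈_)
open import Data.List.Membership.Propositional.Properties using (∈-∃++; ∈-++⁻)
open import Data.Product using (_×_; _,_; ∃-syntax; map₁; map₂)
open import Data.Sum using (inj₁; inj₂)
open import Data.Unit using (⊤; tt)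
open import Relation.Binary.PropositionalEquality

endHeightFrom : ℕ → List Bool → ℕ
endHeightFrom c [] = c
endHeightFrom c (true ∷ w) = endHeightFrom (suc c) w
endHeightFrom c (false ∷ w) = endHeightFrom (c ∸ 1) w

start≤maxHeightFrom : ∀ c w → c ≤ maxHeightFrom c w
start≤maxHeightFrom c [] = ≤-refl
start≤maxHeightFrom c (true ∷ w) = m≤m⊔n c _
start≤maxHeightFrom c (false ∷ w) = m≤m⊔n c _

endHeightFrom≤maxHeightFrom : ∀ c w → endHeightFrom c w ≤ maxHeightFrom c w
endHeightFrom≤maxHeightFrom c [] = ≤-refl
endHeightFrom≤maxHeightFrom c (true ∷ w) =
  ≤-trans (endHeightFrom≤maxHeightFrom (suc c) w) (m≤n⊔m c _)
endHeightFrom≤maxHeightFrom c (false ∷ w) =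
  ≤-trans (endHeightFrom≤maxHeightFrom (c ∸ 1) w) (m≤n⊔m c _)

maxHeightFrom-mono : ∀ {c c'} w → c ≤ c' → maxHeightFrom c w ≤ maxHeightFrom c' w
maxHeightFrom-mono [] c≤c' = c≤c'
maxHeightFrom-mono (true ∷ w) c≤c' = ⊔-mono-≤ c≤c' (maxHeightFrom-mono w (s≤s c≤c'))
maxHeightFrom-mono (false ∷ w) c≤c' = ⊔-mono-≤ c≤c' (maxHeightFrom-mono w (∸-monoˡ-≤ 1 c≤c'))

maxHeightFrom-++ : ∀ c a b →
  maxHeightFrom c (a ++ b) ≡ maxHeightFrom c a ⊔ maxHeightFrom (endHeightFrom c a) b
maxHeightFrom-++ c [] b = sym (m≤n⇒m⊔n≡n (start≤maxHeightFrom c b))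
maxHeightFrom-++ c (true ∷ a) b =
  trans (cong (c ⊔_) (maxHeightFrom-++ (suc c) a b)) (sym (⊔-assoc c _ _))
maxHeightFrom-++ c (false ∷ a) b =
  trans (cong (c ⊔_) (maxHeightFrom-++ (c ∸ 1) a b)) (sym (⊔-assoc c _ _))

maxHeightFrom-++ˡ : ∀ c a b → maxHeightFrom c a ≤ maxHeightFrom c (a ++ b)
maxHeightFrom-++ˡ c a b = ≤-trans (m≤m⊔n _ _) (≤-reflexive (sym (maxHeightFrom-++ c a b)))

maxHeightFrom-++ʳ : ∀ c a b → maxHeightFrom (endHeightFrom c a) b ≤ maxHeightFrom c (a ++ b)
maxHeightFrom-++ʳ c a b = ≤-trans (m≤n⊔m _ _) (≤-reflexive (sym (maxHeightFrom-++ c a b)))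

height-infix≤ : ∀ a w b → height w ≤ height (a ++ w ++ b)
height-infix≤ a w b = begin
  maxHeightFrom 0 w                        ≤⟨ maxHeightFrom-mono w z≤n ⟩
  maxHeightFrom (endHeightFrom 0 a) w      ≤⟨ maxHeightFrom-++ˡ _ w b ⟩
  maxHeightFrom (endHeightFrom 0 a) (w ++ b) ≤⟨ maxHeightFrom-++ʳ 0 a (w ++ b) ⟩
  height (a ++ w ++ b)                     ∎
  where open ≤-Reasoning

height-∈-concat≤ : ∀ {y ys} → y ∈ ys → height y ≤ height (concat ys)
height-∈-concat≤ {y} y∈ys with a , b , refl ← ∈-∃++ y∈ys =
  subst (λ z → height y ≤ height z) (concat-++ a (y ∷ b)) (height-infix≤ (concat a) y (concat b))

dyckFrom-++ʳ : ∀ d a b → T (dyckFrom d (a ++ b)) → T (dyckFrom (endHeightFrom d a) b)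
dyckFrom-++ʳ d [] b t = t
dyckFrom-++ʳ zero (true ∷ a) b t = dyckFrom-++ʳ 1 a b t
dyckFrom-++ʳ (suc d) (true ∷ a) b t = dyckFrom-++ʳ (suc (suc d)) a b t
dyckFrom-++ʳ (suc d) (false ∷ a) b t = dyckFrom-++ʳ d a b t

maxHeightFrom-suc : ∀ d w → T (dyckFrom d w) → maxHeightFrom (suc d) w ≡ suc (maxHeightFrom d w)
maxHeightFrom-suc d [] t = refl
maxHeightFrom-suc zero (true ∷ w) t = cong (1 ⊔_) (maxHeightFrom-suc 1 w t)
maxHeightFrom-suc (suc d) (true ∷ w) t = cong (suc (suc d) ⊔_) (maxHeightFrom-suc (suc (suc d)) w t)
maxHeightFrom-suc (suc d) (false ∷ w) t = cong (suc (suc d) ⊔_) (maxHeightFrom-suc d w t)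

height<height-Dyck' : ∀ u → Dyck u → height u < height (true ∷ u ++ false ∷ [])
height<height-Dyck' u du = begin-strict
  height u                       <⟨ ≤-refl ⟩
  suc (height u)                 ≡⟨ sym (maxHeightFrom-suc 0 u du) ⟩
  maxHeightFrom 1 u              ≤⟨ maxHeightFrom-++ˡ 1 u (false ∷ []) ⟩
  height (true ∷ u ++ false ∷ []) ∎
  where open ≤-Reasoning

-- w starts at height e and, being followed by s, stays nonnegative; the splits on e and c
-- below are only there to let dyckFrom compute.
maxHeightFrom-compl≤ : ∀ e c w s → T (dyckFrom e (w ++ s)) → T (dyckFrom c (compl w)) →
  maxHeightFrom c (compl w) ≤ c + e
maxHeightFrom-compl≤ e c [] s _ _ = m≤m+n c e
maxHeightFrom-compl≤ zero (suc c) (true ∷ w) s t t' =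
  ⊔-lub (s≤s (m≤m+n c 0)) (≤-trans (maxHeightFrom-compl≤ 1 c w s t t') (≤-reflexive (+-suc c 0)))
maxHeightFrom-compl≤ (suc e) (suc c) (true ∷ w) s t t' =
  ⊔-lub (s≤s (m≤m+n c (suc e)))
    (≤-trans (maxHeightFrom-compl≤ (suc (suc e)) c w s t t') (≤-reflexive (+-suc c (suc e))))
maxHeightFrom-compl≤ (suc e) zero (false ∷ w) s t t' =
  ⊔-lub z≤n (maxHeightFrom-compl≤ e 1 w s t t')
maxHeightFrom-compl≤ (suc e) (suc c) (false ∷ w) s t t' =
  ⊔-lub (m≤m+n (suc c) (suc e))
    (≤-trans (maxHeightFrom-compl≤ e (suc (suc c)) w s t t') (≤-reflexive (sym (+-suc (suc c) e))))

height-compl-infix≤ : ∀ a w b → Dyck (a ++ w ++ b) → Dyck (compl w) →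
  height (compl w) ≤ height (a ++ w ++ b)
height-compl-infix≤ a w b du dw = begin
  height (compl w)     ≤⟨ maxHeightFrom-compl≤ _ 0 w b (dyckFrom-++ʳ 0 a (w ++ b) du) dw ⟩
  endHeightFrom 0 a    ≤⟨ endHeightFrom≤maxHeightFrom 0 a ⟩
  height a             ≤⟨ maxHeightFrom-++ˡ 0 a (w ++ b) ⟩
  height (a ++ w ++ b) ∎
  where open ≤-Reasoning

WellFormed : Piece → Set
WellFormed (uPart u) = Dyck u
WellFormed (vPart v) = Dyck (compl v)
WellFormed letter1 = ⊤
WellFormed letter0 = ⊤

data RecursesOn : Piece → List Bool → Set where
  onU : ∀ {u} → RecursesOn (uPart u) u
  onV : ∀ {v} → RecursesOn (vPart v) (compl v)

height-recursion≤ : ∀ a b {c w} → Dyck (a ++ pieceWord c ++ b) → WellFormed c → RecursesOn c w →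
  height w ≤ height (a ++ pieceWord c ++ b)
height-recursion≤ a b _ _ (onU {u}) = height-infix≤ a u b
height-recursion≤ a b du dv (onV {v}) = height-compl-infix≤ a v b du dv

∈-subWords⁻ : ∀ p cs {q w} → (q , w) ∈ subWords (layout p cs) → ∃[ c ] c ∈ cs × RecursesOn c w
∈-subWords⁻ p (letter1 ∷ cs) m = map₂ (map₁ there) (∈-subWords⁻ _ cs m)
∈-subWords⁻ p (letter0 ∷ cs) m = map₂ (map₁ there) (∈-subWords⁻ _ cs m)
∈-subWords⁻ p (uPart u ∷ cs) (here refl) = uPart u , here refl , onU
∈-subWords⁻ p (uPart u ∷ cs) (there m) = map₂ (map₁ there) (∈-subWords⁻ _ cs m)
∈-subWords⁻ p (vPart v ∷ cs) (here refl) = vPart v , here refl , onV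
∈-subWords⁻ p (vPart v ∷ cs) (there m) = map₂ (map₁ there) (∈-subWords⁻ _ cs m)

∈-offsets⁻ : ∀ q ys {r y} → (r , y) ∈ offsets q ys → y ∈ ys
∈-offsets⁻ q (w ∷ ws) (here refl) = here refl
∈-offsets⁻ q (w ∷ ws) (there m) = there (∈-offsets⁻ _ ws m)

∈-framed⁻ : ∀ {c w} (body : List Piece) → RecursesOn c w →
  c ∈ letter1 ∷ body ++ letter0 ∷ [] → c ∈ body
∈-framed⁻ body () (here refl)
∈-framed⁻ body r (there c∈) with ∈-++⁻ body c∈
... | inj₁ c∈body = c∈body
∈-framed⁻ body () (there c∈) | inj₂ (here refl)

shapeOf-framed : ∀ us vs → ∃[ body ] shapeOf us vs ≡ letter1 ∷ body ++ letter0 ∷ []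
shapeOf-framed [] vs = letter1 ∷ concatMap (λ v → vPart v ∷ letter0 ∷ []) vs , refl
shapeOf-framed (u ∷ us) vs with body , eq ← shapeOf-framed us vs =
  uPart u ∷ letter1 ∷ body , cong (λ cs → letter1 ∷ uPart u ∷ cs) eq

shape-framed : ∀ {h cs} → Shape h cs → ∃[ body ] cs ≡ letter1 ∷ body ++ letter0 ∷ []
shape-framed shape1 = [] , refl
shape-framed (shapeN us vs _ _ _) = shapeOf-framed us vs

shape-wellFormed : ∀ {h cs} → Shape h cs → All WellFormed cs
shape-wellFormed shape1 = tt ∷ tt ∷ []
shape-wellFormed (shapeN _ _ dus dvs _) = shapeOf-wellFormed dus dvs
  where
  vParts-wellFormed : ∀ {vs} → All (λ v → Dyck (compl v)) vs →
    All WellFormed (concatMap (λ v → vPart v ∷ letter0 ∷ []) vs)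
  vParts-wellFormed [] = []
  vParts-wellFormed (dv ∷ dvs) = dv ∷ tt ∷ vParts-wellFormed dvs
  shapeOf-wellFormed : ∀ {us vs} → All Dyck us → All (λ v → Dyck (compl v)) vs →
    All WellFormed (shapeOf us vs)
  shapeOf-wellFormed [] dvs = tt ∷ tt ∷ ++⁺ (vParts-wellFormed dvs) (tt ∷ [])
  shapeOf-wellFormed (du ∷ dus) dvs = tt ∷ du ∷ shapeOf-wellFormed dus dvs

letter1Count : List Piece → ℕ
letter1Count [] = 0
letter1Count (letter1 ∷ cs) = suc (letter1Count cs)
letter1Count (letter0 ∷ cs) = letter1Count cs
letter1Count (uPart _ ∷ cs) = letter1Count cs
letter1Count (vPart _ ∷ cs) = letter1Count cs

speed-gliderOf : ∀ p cs → speed (gliderOf p cs) ≡ letter1Count cs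
speed-gliderOf p [] = refl
speed-gliderOf p (letter1 ∷ cs) = cong suc (speed-gliderOf _ cs)
speed-gliderOf p (letter0 ∷ cs) = speed-gliderOf _ cs
speed-gliderOf p (uPart _ ∷ cs) = speed-gliderOf _ cs
speed-gliderOf p (vPart _ ∷ cs) = speed-gliderOf _ cs

shape-letter1Count : ∀ {h cs} → Shape h cs → letter1Count cs ≡ h
shape-letter1Count shape1 = refl
shape-letter1Count (shapeN us vs _ _ _) = shapeOf-letter1Count us
  where
  vParts-letter1Count : ∀ vs →
    letter1Count (concatMap (λ v → vPart v ∷ letter0 ∷ []) vs ++ letter0 ∷ []) ≡ 0
  vParts-letter1Count [] = refl
  vParts-letter1Count (v ∷ vs) = vParts-letter1Count vs
  shapeOf-letter1Count : ∀ us → letter1Count (shapeOf us vs) ≡ 2 + length us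
  shapeOf-letter1Count [] = cong (2 +_) (vParts-letter1Count vs)
  shapeOf-letter1Count (u ∷ us) = cong suc (shapeOf-letter1Count us)

flatten-framed : ∀ u body → flatten (letter1 ∷ body ++ letter0 ∷ []) ≡ true ∷ u ++ false ∷ [] →
  u ≡ flatten body
flatten-framed u body flat =
  ∷ʳ-injectiveˡ u (flatten body) (trans (∷-injectiveʳ (sym flat)) (concatMap-++ pieceWord body (letter0 ∷ [])))

speed-decomposition : ∀ {y h cs} p → Decomposition y h cs → speed (gliderOf p cs) ≡ h
speed-decomposition {cs = cs} p (_ , _ , sh , _) = trans (speed-gliderOf p cs) (shape-letter1Count sh)

height-subWord< : ∀ {y h cs p q w} → Decomposition y h cs →
  (q , w) ∈ subWords (layout p cs) → height w < h
height-subWord< {cs = cs} {p} {w = w} ((u , du , refl) , refl , sh , flat) w∈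
  with c , c∈cs , r ← ∈-subWords⁻ p cs w∈ | body , refl ← shape-framed sh
  with a , b , refl ← ∈-∃++ (∈-framed⁻ body r c∈cs) = begin-strict
    height w                        ≤⟨ height-recursion≤ a′ b′ (subst Dyck u≡ du) wf r ⟩
    height (a′ ++ pieceWord c ++ b′) ≡⟨ cong height u≡ ⟨
    height u                        <⟨ height<height-Dyck' u du ⟩
    height (true ∷ u ++ false ∷ []) ∎
  where
  open ≤-Reasoning
  a′ b′ : List Bool
  a′ = flatten a
  b′ = flatten b
  wf : WellFormed c
  wf = All.lookup (shape-wellFormed sh) c∈cs
  u≡ : u ≡ a′ ++ pieceWord c ++ b′
  u≡ = trans (flatten-framed u (a ++ c ∷ b) flat) (concatMap-++ pieceWord a (c ∷ b))

lemma12 : (k n : ℕ) → 1 ≤ k → 2 * k + 1 ≤ n →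
          (x : Vec Bool n) → countOnes x ≡ k →
          (γ γ' : Glider) → InΓ x γ → InΓ x γ' → Child x γ γ' →
          speed γ' < speed γ
lemma12 _ _ _ _ _ _ _ _ _ _
  (p , _ , h , cs , _ , dec , refl , q , _ , w∈ , ys , _ , refl ,
   r , y' , y'∈ , _ , cs' , dec'@(_ , refl , _) , refl) = begin-strict
    speed (gliderOf r cs') ≡⟨ speed-decomposition r dec' ⟩
    height y'              ≤⟨ height-∈-concat≤ (∈-offsets⁻ q ys y'∈) ⟩
    height (concat ys)     <⟨ height-subWord< dec w∈ ⟩
    h                      ≡⟨ speed-decomposition p dec ⟨
    speed (gliderOf p cs)  ∎
  where open ≤-Reasoning
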